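{- If $G$ is a nice connected graph with $n$ vertices and $m$ edges, then ${\rm ML}^{\rm W}(G) \leq 2(m+n-1)$. In particular, ${\rm ML}^{\rm W}(G) \leq 4m$.
   Context: All graphs are finite and simple. A graph is nice if it is connected and not isomorphic to $K_2$. A walk of $G$ is a sequence of vertices in which consecutive vertices are adjacent (vertices and edges may repeat); its length is the number of traversed edges counted with repetition. For a walk $W$, $G+W$ is the multigraph on $V(G)$ whose edge multiset is $E(G)$ together with all edges traversed by $W$, each added as many times as it is traversed. A multigraph is locally irregular if no two adjacent vertices have the same degree. A walk $W$ is irregularising if $G+W$ is locally irregular. ${\rm ML}^{\rm W}(G)$ is the minimum length of an irregularising walk of $G$ (length $0$ allowed), and $+\infty$ if none exists. -}

module Defs where

open import Data.Nat using (ℕ; zero; suc; _+_; _*_; _∸_; _≤_; _<_)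
open import Data.Bool using (Bool; true; false; if_then_else_; _∧_)
open import Data.Fin using (Fin; zero; suc; _≟_; toℕ)
open import Data.Fin.Properties using () renaming (_<?_ to _<ᶠ?_)
open import Data.Unit using (⊤)
open import Data.List using (List; []; _∷_; length)
open import Data.Product using (Σ; _×_; _,_; ∃)
open import Relation.Nullary using (¬_; does)
open import Relation.Binary.PropositionalEquality using (_≡_; _≢_)

record Graph (n : ℕ) : Set where
  field
    adj   : Fin n → Fin n → Bool
    sym   : ∀ u v → adj u v ≡ adj v u
    irrefl : ∀ v → adj v v ≡ false
open Graph public

count : ∀ {n} → (Fin n → Bool) → ℕ
count {zero}  p = 0
count {suc n} p = (if p zero then 1 else 0) + count (λ i → p (suc i))

sumFin : ∀ {n} → (Fin n → ℕ) → ℕ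
sumFin {zero}  f = 0
sumFin {suc n} f = f zero + sumFin (λ i → f (suc i))

deg : ∀ {n} → Graph n → Fin n → ℕ
deg G v = count (λ u → adj G v u)

edges : ∀ {n} → Graph n → ℕ
edges G = sumFin (λ i → count (λ j → adj G i j ∧ does (i <ᶠ? j)))

IsWalk : ∀ {n} → Graph n → Fin n → List (Fin n) → Set
IsWalk G v []       = ⊤
IsWalk G v (w ∷ ws) = (adj G v w ≡ true) × IsWalk G w ws

-- a walk is a start vertex together with the list of subsequent vertices;
-- its length is the number of traversed edges
record Walk {n} (G : Graph n) : Set where
  constructor walk
  field
    start : Fin n
    rest  : List (Fin n)
    valid : IsWalk G start rest
open Walk public

walkLength : ∀ {n} {G : Graph n} → Walk G → ℕ
walkLength W = length (rest W)

[_≡ᵇ_] : ∀ {n} → Fin n → Fin n → ℕ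
[ a ≡ᵇ b ] = if does (a ≟ b) then 1 else 0

-- number of (counted-with-repetition) walk edges incident to x,
-- for the walk v, ws
extraDeg : ∀ {n} → Fin n → List (Fin n) → Fin n → ℕ
extraDeg v []       x = 0
extraDeg v (w ∷ ws) x = [ v ≡ᵇ x ] + [ w ≡ᵇ x ] + extraDeg w ws x

-- degree of x in the multigraph G + W
degPlus : ∀ {n} (G : Graph n) → Walk G → Fin n → ℕ
degPlus G W x = deg G x + extraDeg (start W) (rest W) x

-- G + W is locally irregular.  Its underlying adjacency equals that of G,
-- since W only traverses edges of G.
Irregularising : ∀ {n} (G : Graph n) → Walk G → Set
Irregularising G W = ∀ u v → adj G u v ≡ true → degPlus G W u ≢ degPlus G W v

-- ML^W(G) ≤ k  (ML^W is a minimum over irregularising walks, +∞ if none)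
MLW≤ : ∀ {n} (G : Graph n) → ℕ → Set
MLW≤ G k = Σ (Walk G) λ W → Irregularising G W × walkLength W ≤ k

Connected : ∀ {n} → Graph n → Set
Connected {n} G =
  (0 < n) × (∀ u v → Σ (List (Fin n)) λ ws →
                IsWalk G u ws × lastOr u ws ≡ v)
  where
  lastOr : Fin n → List (Fin n) → Fin n
  lastOr u []       = u
  lastOr u (w ∷ ws) = lastOr w ws

IsoK2 : ∀ {n} → Graph n → Set
IsoK2 {n} G = (n ≡ 2) × (∀ u v → u ≢ v → adj G u v ≡ true)

Nice : ∀ {n} → Graph n → Set
Nice G = Connected G × ¬ IsoK2 G

{-# OPTIONS --safe #-}
-- Fix a spanning tree with a search order of its vertices: the root r comes first, every
-- later vertex is attached to an earlier one, its parent, and the first two vertices after r,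
-- B and A, are both children of r.  The walk runs back and forth c_v ≥ 1 times along the edge
-- from each non-root vertex v to its parent; this costs 2 c_v steps and raises the degrees of
-- v and of its parent by 2 c_v each.
--
-- The c_v are chosen in reverse search order.  Choosing c_v moves only v and its parent,
-- which comes earlier, so the degrees of the vertices chosen before v are already final; each
-- of the d neighbours of v among them forbids at most one value of c_v, so some c_v ≤ d + 1
-- separates v from all of them.  The root is moved only by its children: A also separates r
-- from B, and B, which moves itself and r by the same amount, also separates r from its
-- remaining neighbours.
--
-- Every edge is charged at most once, so Σ (c_v − 1) ≤ m and the walk has length
-- 2 (n − 1 + Σ (c_v − 1)) ≤ 2 (m + n − 1), which is at most 4m as n − 1 ≤ m.

module Submission where

open import Defs hiding (sym)
open import Data.Bool using (Bool; true; false; _∧_; _∨_; if_then_else_)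
open import Data.Bool.Properties using (∧-identityʳ) renaming (_≟_ to _≟ᵇ_)
open import Data.Empty using (⊥-elim)
open import Data.Fin using (Fin; zero; suc; _≟_)
open import Data.Fin.Properties using (all?; ¬∀⟶∃¬) renaming (_<?_ to _<ᶠ?_; <-cmp to <ᶠ-cmp)
open import Data.List using (List; []; _∷_; _++_; [_]; length; map; filter)
open import Data.List.Properties using (length-map; length-++; filter-notAll; filter-accept; filter-all)
open import Data.List.Relation.Unary.All as All using (All; []; _∷_)
open import Data.List.Relation.Unary.All.Properties
  using (¬Any⇒All¬; All¬⇒¬Any; ++⁻ˡ; ++⁻ʳ; map⁻)
open import Data.List.Relation.Unary.AllPairs using ([]; _∷_)
open import Data.List.Relation.Unary.Any as Any using (here; there; any?)
open import Data.List.Relation.Unary.Unique.Propositional using (Unique)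
open import Data.List.Membership.Propositional using (_∈_; _∉_)
open import Data.List.Membership.Propositional.Properties using (∈-map⁺; ∈-filter⁺; ∈-++⁺ʳ)
import Data.List.Membership.DecPropositional as DecMembership
open import Data.Nat using (ℕ; zero; suc; pred; _+_; _*_; _∸_; _≤_; _<_; z≤n; s≤s)
open import Data.Nat.Properties
  using ( ≤-refl; ≤-trans; ≤-reflexive; ≤-pred; <-irrefl; m≤n⇒m≤1+n; m≤m+n; m≤n+m
        ; +-identityʳ; +-comm; +-suc; *-suc; *-comm; *-zeroʳ; *-identityʳ
        ; +-mono-≤; +-monoˡ-≤; *-monoʳ-≤; +-cancelʳ-≡; m+n∸m≡n; +-commutativeSemigroup
        ; module ≤-Reasoning )
  renaming (_≟_ to _≟ℕ_)
open import Algebra.Properties.CommutativeSemigroup +-commutativeSemigroup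
  using (interchange; x∙yz≈y∙xz; x∙yz≈yx∙z; x∙yz≈xz∙y)
open import Data.Nat.DivMod using (_/_; m*n/n≡m)
open import Data.Nat.Tactic.RingSolver using (solve-∀)
open import Data.Product using (_×_; _,_; proj₁; proj₂; ∃-syntax)
open import Data.Sum using (_⊎_; inj₁; inj₂)
open import Data.Unit using (tt)
open import Function using (_∘_)
open import Relation.Nullary using (Dec; yes; no; does; ¬_; ¬?)
open import Relation.Nullary.Decidable using (dec-true; dec-false)
open import Relation.Binary.Definitions using (tri<; tri≈; tri>)
open import Relation.Binary.PropositionalEquality
  using (_≡_; _≢_; refl; sym; trans; cong; cong₂; subst; module ≡-Reasoning)

lower : List ℕ → List ℕ
lower xs = map pred (filter (λ y → ¬? (y ≟ℕ 0)) xs)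

lower-shorter : ∀ {xs} → 0 ∈ xs → length (lower xs) < length xs
lower-shorter {xs} 0∈xs =
  subst (_< length xs) (sym (length-map pred (filter (λ y → ¬? (y ≟ℕ 0)) xs)))
    (filter-notAll (λ y → ¬? (y ≟ℕ 0)) xs (Any.map (λ 0≡y y≢0 → y≢0 (sym 0≡y)) 0∈xs))

lower-∈ : ∀ {a xs} → suc a ∈ xs → a ∈ lower xs
lower-∈ 1+a∈xs = ∈-map⁺ pred (∈-filter⁺ (λ y → ¬? (y ≟ℕ 0)) 1+a∈xs λ ())

avoid : (xs : List ℕ) → ∃[ a ] a ≤ length xs × a ∉ xs
avoid xs = avoid-within (length xs) xs ≤-refl
  where
  avoid-within : ∀ bound xs → length xs ≤ bound → ∃[ a ] a ≤ length xs × a ∉ xs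
  avoid-within bound xs len≤ with any? (0 ≟ℕ_) xs
  ... | no 0∉xs = 0 , z≤n , 0∉xs
  avoid-within zero [] _ | yes ()
  avoid-within zero (_ ∷ _) () | yes _
  avoid-within (suc bound) xs len≤ | yes 0∈xs
    with avoid-within bound (lower xs) (≤-pred (≤-trans (lower-shorter 0∈xs) len≤))
  ... | a , a≤ , a∉ = suc a , ≤-trans (s≤s a≤) (lower-shorter 0∈xs) , a∉ ∘ lower-∈

-- the only k with c + 2 (k + 1) ≡ d, if there is one
collision : ℕ × ℕ → ℕ
collision (c , d) = (d ∸ c) / 2 ∸ 1

collision-unique : ∀ c k → collision (c , c + 2 * suc k) ≡ k
collision-unique c k = begin
  (c + 2 * suc k ∸ c) / 2 ∸ 1  ≡⟨ cong (λ d → d / 2 ∸ 1) (m+n∸m≡n c (2 * suc k)) ⟩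
  2 * suc k / 2 ∸ 1            ≡⟨ cong (λ d → d / 2 ∸ 1) (*-comm 2 (suc k)) ⟩
  suc k * 2 / 2 ∸ 1            ≡⟨ cong (_∸ 1) (m*n/n≡m (suc k) 2) ⟩
  k                            ∎
  where open ≡-Reasoning

Avoids : ℕ → ℕ × ℕ → Set
Avoids k (c , d) = c + 2 * suc k ≢ d

chooseShift : (cs : List (ℕ × ℕ)) → ∃[ k ] k ≤ length cs × All (Avoids k) cs
chooseShift cs with avoid (map collision cs)
... | k , k≤ , k∉ = k , subst (k ≤_) (length-map collision cs) k≤ , All.tabulate avoids
  where
  avoids : ∀ {cd} → cd ∈ cs → Avoids k cd
  avoids {c , _} cd∈cs refl =
    k∉ (subst (_∈ map collision cs) (collision-unique c k) (∈-map⁺ collision cd∈cs))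

walk-budget : ∀ {n l s m} → n ≡ suc l → l ≤ m → s ≤ m →
  2 * (l + s) ≤ 2 * (m + n ∸ 1) × 2 * (l + s) ≤ 4 * m
walk-budget {l = l} {s} {m} refl l≤m s≤m rewrite +-suc m l =
  *-monoʳ-≤ 2 (subst (_≤ m + l) (+-comm s l) (+-monoˡ-≤ l s≤m)) ,
  subst (2 * (l + s) ≤_) (double m) (*-monoʳ-≤ 2 (+-mono-≤ l≤m s≤m))
  where
  double : ∀ m → 2 * (m + m) ≡ 4 * m
  double = solve-∀

unique-∷ : ∀ {A : Set} {x : A} {xs} → x ∉ xs → Unique xs → Unique (x ∷ xs)
unique-∷ x∉xs uxs = ¬Any⇒All¬ _ x∉xs ∷ uxs

distinct : ∀ {A : Set} {x y : A} {xs} → x ∉ xs → y ∈ xs → x ≢ y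
distinct x∉xs y∈xs refl = x∉xs y∈xs

-- does (z ∈? v ∷ L) reduces to does (z ≟ v) ∨ does (z ∈? L), the shape used by count-insert.
_∈?_ : ∀ {n} (x : Fin n) xs → Dec (x ∈ xs)
x ∈? xs = DecMembership._∈?_ _≟_ x xs

ind : Bool → ℕ
ind b = if b then 1 else 0

≡ᵇ-refl : ∀ {n} (x : Fin n) → [ x ≡ᵇ x ] ≡ 1
≡ᵇ-refl x rewrite dec-true (x ≟ x) refl = refl

≡ᵇ-≢ : ∀ {n} {x y : Fin n} → x ≢ y → [ x ≡ᵇ y ] ≡ 0
≡ᵇ-≢ {x = x} {y} x≢y rewrite dec-false (x ≟ y) x≢y = refl

sumFin-ext : ∀ {n} {f g : Fin n → ℕ} → (∀ i → f i ≡ g i) → sumFin f ≡ sumFin g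
sumFin-ext {zero}  _  = refl
sumFin-ext {suc n} eq = cong₂ _+_ (eq zero) (sumFin-ext (eq ∘ suc))

sumFin-+ : ∀ {n} (f g : Fin n → ℕ) → sumFin (λ i → f i + g i) ≡ sumFin f + sumFin g
sumFin-+ {zero}  _ _ = refl
sumFin-+ {suc n} f g =
  trans (cong (f zero + g zero +_) (sumFin-+ (f ∘ suc) (g ∘ suc)))
        (interchange (f zero) (g zero) (sumFin (f ∘ suc)) (sumFin (g ∘ suc)))

sumFin-override : ∀ {n} (f : Fin n → ℕ) c v → f v ≡ 0 →
  sumFin (λ i → if does (i ≟ v) then c else f i) ≡ c + sumFin f
sumFin-override {suc n} f c zero    fv rewrite fv = refl
sumFin-override {suc n} f c (suc v) fv =
  trans (cong (f zero +_) (sumFin-override (f ∘ suc) c v fv))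
        (x∙yz≈y∙xz (f zero) c (sumFin (f ∘ suc)))

count≡sumFin : ∀ {n} (p : Fin n → Bool) → count p ≡ sumFin (ind ∘ p)
count≡sumFin {zero}  _ = refl
count≡sumFin {suc n} p = cong (ind (p zero) +_) (count≡sumFin (p ∘ suc))

count-ext : ∀ {n} {p q : Fin n → Bool} → (∀ i → p i ≡ q i) → count p ≡ count q
count-ext {zero}  _  = refl
count-ext {suc n} eq = cong₂ _+_ (cong ind (eq zero)) (count-ext (eq ∘ suc))

count-false : ∀ {n} → count {n} (λ _ → false) ≡ 0
count-false {zero}  = refl
count-false {suc n} = count-false {n}

count-true : ∀ {n} → count {n} (λ _ → true) ≡ n
count-true {zero}  = refl
count-true {suc n} = cong suc (count-true {n})

count-≤ : ∀ {n} (p : Fin n → Bool) → count p ≤ n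
count-≤ {zero}  _ = z≤n
count-≤ {suc n} p with p zero
... | true  = s≤s (count-≤ (p ∘ suc))
... | false = m≤n⇒m≤1+n (count-≤ (p ∘ suc))

count-split : ∀ {n} {p q r : Fin n → Bool} → (∀ i → ind (p i) + ind (q i) ≡ ind (r i)) →
  count p + count q ≡ count r
count-split {zero}  _  = refl
count-split {suc n} {p} {q} {r} eq =
  trans (interchange (ind (p zero)) (count (p ∘ suc)) (ind (q zero)) (count (q ∘ suc)))
        (cong₂ _+_ (eq zero) (count-split {p = p ∘ suc} {q ∘ suc} {r ∘ suc} (eq ∘ suc)))

count-insert : ∀ {n} (M q : Fin n → Bool) v → M v ≡ false →
  count (λ j → (does (j ≟ v) ∨ M j) ∧ q j) ≡ ind (q v) + count (λ j → M j ∧ q j)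
count-insert {suc n} M q zero    Mv rewrite Mv = refl
count-insert {suc n} M q (suc v) Mv =
  trans (cong (ind (M zero ∧ q zero) +_) (count-insert (M ∘ suc) (q ∘ suc) v Mv))
        (x∙yz≈y∙xz (ind (M zero ∧ q zero)) (ind (q (suc v)))
                   (count (λ j → M (suc j) ∧ q (suc j))))

count-∈-∧ : ∀ {n} (q : Fin n → Bool) {L} → Unique L →
  count (λ z → does (z ∈? L) ∧ q z) ≡ length (filter (λ z → q z ≟ᵇ true) L)
count-∈-∧ {n} q {[]}    []          = count-false {n}
count-∈-∧     q {v ∷ L} (v∉L ∷ uL) = begin
  count (λ z → (does (z ≟ v) ∨ does (z ∈? L)) ∧ q z)
    ≡⟨ count-insert (λ z → does (z ∈? L)) q v (dec-false (v ∈? L) (All¬⇒¬Any v∉L)) ⟩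
  ind (q v) + count (λ z → does (z ∈? L) ∧ q z)
    ≡⟨ cong (ind (q v) +_) (count-∈-∧ q uL) ⟩
  ind (q v) + length (filter (λ z → q z ≟ᵇ true) L)
    ≡⟨ filter-∷ ⟩
  length (filter (λ z → q z ≟ᵇ true) (v ∷ L)) ∎
  where
  open ≡-Reasoning
  filter-∷ : ind (q v) + length (filter (λ z → q z ≟ᵇ true) L)
           ≡ length (filter (λ z → q z ≟ᵇ true) (v ∷ L))
  filter-∷ with q v
  ... | true  = refl
  ... | false = refl

count-∈ : ∀ {n} {L : List (Fin n)} → Unique L → count (λ z → does (z ∈? L)) ≡ length L
count-∈ {L = L} uL = begin
  count (λ z → does (z ∈? L))
    ≡⟨ count-ext {p = λ z → does (z ∈? L)} (λ _ → sym (∧-identityʳ _)) ⟩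
  count (λ z → does (z ∈? L) ∧ true)
    ≡⟨ count-∈-∧ (λ _ → true) uL ⟩
  length (filter (λ _ → true ≟ᵇ true) L)
    ≡⟨ cong length (filter-all _ (All.universal (λ _ → refl) L)) ⟩
  length L ∎
  where open ≡-Reasoning

unique-length-≤ : ∀ {n} {L : List (Fin n)} → Unique L → length L ≤ n
unique-length-≤ uL = subst (_≤ _) (count-∈ uL) (count-≤ _)

unique-spanning-length : ∀ {n} {L : List (Fin n)} → Unique L → (∀ x → x ∈ L) → length L ≡ n
unique-spanning-length {L = L} uL spans =
  trans (sym (count-∈ uL)) (trans (count-ext (λ x → dec-true (x ∈? L) (spans x))) count-true)

module _ {n} (G : Graph n) where

  infix 4 _~_
  _~_ : Fin n → Fin n → Set
  u ~ v = adj G u v ≡ true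

  ~-sym : ∀ {u v} → u ~ v → v ~ u
  ~-sym {u} {v} u~v = trans (Graph.sym G v u) u~v

  ~-irrefl : ∀ {u v} → u ~ v → u ≢ v
  ~-irrefl {u} u~u refl with trans (sym (irrefl G u)) u~u
  ... | ()

  -- Edges inside a vertex set

  arc : Fin n → Fin n → Bool
  arc i j = adj G i j ∧ does (i <ᶠ? j)

  upEdges : (Fin n → Bool) → Fin n → ℕ
  upEdges M i = count (λ j → M i ∧ (M j ∧ arc i j))

  edgesWithin : (Fin n → Bool) → ℕ
  edgesWithin M = sumFin (upEdges M)

  edgesWithin-cong : ∀ {M M′} → (∀ i → M i ≡ M′ i) → edgesWithin M ≡ edgesWithin M′
  edgesWithin-cong eq =
    sumFin-ext (λ i → count-ext (λ j → cong₂ (λ a b → a ∧ (b ∧ arc i j)) (eq i) (eq j)))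

  arc-either : ∀ v j → ind (arc v j) + ind (arc j v) ≡ ind (adj G v j)
  arc-either v j with adj G v j in v~j
  ... | false rewrite trans (Graph.sym G j v) v~j = refl
  ... | true rewrite ~-sym {v} {j} v~j with <ᶠ-cmp v j
  ...   | tri< v<j _ j≮v rewrite dec-true (v <ᶠ? j) v<j | dec-false (j <ᶠ? v) j≮v = refl
  ...   | tri≈ _ v≡j _ = ⊥-elim (~-irrefl v~j v≡j)
  ...   | tri> v≮j _ j<v rewrite dec-false (v <ᶠ? j) v≮j | dec-true (j <ᶠ? v) j<v = refl

  upEdges-insert : ∀ M v → M v ≡ false → ∀ i →
    upEdges (λ j → does (j ≟ v) ∨ M j) i
      ≡ (if does (i ≟ v) then count (λ j → M j ∧ arc v j) else ind (M i ∧ arc i v)) + upEdges M i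
  upEdges-insert M v Mv i with i ≟ v
  ... | yes refl = begin
    count (λ j → (does (j ≟ v) ∨ M j) ∧ arc v j)  ≡⟨ count-insert M (arc v) v Mv ⟩
    ind (arc v v) + X
      ≡⟨ cong (λ b → ind (b ∧ does (v <ᶠ? v)) + X) (irrefl G v) ⟩
    X                                             ≡⟨ sym (+-identityʳ X) ⟩
    X + 0                                         ≡⟨ cong (X +_) (sym no-up-edges) ⟩
    X + upEdges M v                               ∎
    where
    open ≡-Reasoning
    X : ℕ
    X = count (λ j → M j ∧ arc v j)
    no-up-edges : upEdges M v ≡ 0
    no-up-edges = trans (count-ext (λ j → cong (_∧ (M j ∧ arc v j)) Mv)) (count-false {n})
  ... | no _ with M i
  ...   | false = refl
  ...   | true  = count-insert M (arc i) v Mv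

  edgesWithin-insert : ∀ M v → M v ≡ false →
    edgesWithin (λ j → does (j ≟ v) ∨ M j) ≡ count (λ j → M j ∧ adj G v j) + edgesWithin M
  edgesWithin-insert M v Mv = begin
    edgesWithin (λ j → does (j ≟ v) ∨ M j)
      ≡⟨ sumFin-ext (upEdges-insert M v Mv) ⟩
    sumFin (λ i → new i + upEdges M i)
      ≡⟨ sumFin-+ new (upEdges M) ⟩
    sumFin new + edgesWithin M
      ≡⟨ cong (_+ edgesWithin M) (sumFin-override _ _ v (cong (λ b → ind (b ∧ arc v v)) Mv)) ⟩
    count (λ j → M j ∧ arc v j) + sumFin (λ i → ind (M i ∧ arc i v)) + edgesWithin M
      ≡⟨ cong (λ s → count (λ j → M j ∧ arc v j) + s + edgesWithin M)
              (sym (count≡sumFin (λ j → M j ∧ arc j v))) ⟩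
    count (λ j → M j ∧ arc v j) + count (λ j → M j ∧ arc j v) + edgesWithin M
      ≡⟨ cong (_+ edgesWithin M) (count-split either) ⟩
    count (λ j → M j ∧ adj G v j) + edgesWithin M ∎
    where
    open ≡-Reasoning
    new : Fin n → ℕ
    new i = if does (i ≟ v) then count (λ j → M j ∧ arc v j) else ind (M i ∧ arc i v)
    either : ∀ j → ind (M j ∧ arc v j) + ind (M j ∧ arc j v) ≡ ind (M j ∧ adj G v j)
    either j with M j
    ... | false = refl
    ... | true  = arc-either v j

  edgesIn : List (Fin n) → ℕ
  edgesIn L = edgesWithin (λ z → does (z ∈? L))

  neighbours : Fin n → List (Fin n) → List (Fin n)
  neighbours v = filter (λ z → adj G v z ≟ᵇ true)

  edgesIn-∷ : ∀ {v L} → Unique (v ∷ L) → edgesIn (v ∷ L) ≡ length (neighbours v L) + edgesIn L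
  edgesIn-∷ {v} {L} (v∉L ∷ uL) =
    trans (edgesWithin-insert _ v (dec-false (v ∈? L) (All¬⇒¬Any v∉L)))
          (cong (_+ edgesIn L) (count-∈-∧ (adj G v) uL))

  edgesIn-spanning : ∀ {L} → (∀ x → x ∈ L) → edgesIn L ≡ edges G
  edgesIn-spanning {L} spans = edgesWithin-cong (λ x → dec-true (x ∈? L) (spans x))

  -- Tree orders

  vertices : List (Fin n × Fin n) → List (Fin n)
  vertices = map proj₁

  data TreeOrder : List (Fin n) → List (Fin n × Fin n) → Set where
    []     : ∀ {S} → TreeOrder S []
    attach : ∀ {S v p xs} → p ∈ S → p ~ v → v ∉ S → TreeOrder (v ∷ S) xs →
             TreeOrder S ((v , p) ∷ xs)

  reached : List (Fin n) → List (Fin n × Fin n) → List (Fin n)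
  reached S []             = S
  reached S ((v , _) ∷ xs) = reached (v ∷ S) xs

  ∈-reached⁻ : ∀ {S} xs {x} → x ∈ reached S xs → x ∈ S ⊎ x ∈ vertices xs
  ∈-reached⁻ []             x∈ = inj₁ x∈
  ∈-reached⁻ ((v , _) ∷ xs) x∈ with ∈-reached⁻ xs x∈
  ... | inj₁ (here x≡v)  = inj₂ (here x≡v)
  ... | inj₁ (there x∈S) = inj₁ x∈S
  ... | inj₂ x∈xs        = inj₂ (there x∈xs)

  reached-unique : ∀ {S xs} → TreeOrder S xs → Unique S → Unique (reached S xs)
  reached-unique []                  uS = uS
  reached-unique (attach _ _ v∉S T) uS = reached-unique T (unique-∷ v∉S uS)

  fresh : ∀ {S xs y} → TreeOrder S xs → y ∈ S → y ∉ vertices xs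
  fresh (attach _ _ v∉S _) y∈S (here refl)  = v∉S y∈S
  fresh (attach _ _ _ T)   y∈S (there y∈xs) = fresh T (there y∈S) y∈xs

  vertices-unique : ∀ {S xs} → TreeOrder S xs → Unique (vertices xs)
  vertices-unique []               = []
  vertices-unique (attach _ _ _ T) = unique-∷ (fresh T (here refl)) (vertices-unique T)

  rooted-unique : ∀ {r xs} → TreeOrder (r ∷ []) xs → Unique (r ∷ vertices xs)
  rooted-unique T = unique-∷ (fresh T (here refl)) (vertices-unique T)

  rooted-spanning : ∀ {r xs} → (∀ x → x ∈ reached (r ∷ []) xs) →
    ∀ x → x ∈ r ∷ vertices xs
  rooted-spanning {xs = xs} spans x with ∈-reached⁻ xs (spans x)
  ... | inj₁ (here x≡r) = here x≡r
  ... | inj₂ x∈xs      = there x∈xs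

  rooted-size : ∀ {r xs} → TreeOrder (r ∷ []) xs → (∀ x → x ∈ reached (r ∷ []) xs) →
    n ≡ suc (length xs)
  rooted-size {xs = xs} T spans =
    trans (sym (unique-spanning-length (rooted-unique T) (rooted-spanning spans)))
          (cong suc (length-map proj₁ xs))

  edgesIn-reached : ∀ {S xs} → TreeOrder S xs → Unique S →
    edgesIn S + length xs ≤ edgesIn (reached S xs)
  edgesIn-reached []                                        uS = ≤-reflexive (+-identityʳ _)
  edgesIn-reached {S} (attach {v = v} {xs = xs} p∈S p~v v∉S T) uS = begin
    edgesIn S + suc (length xs)                      ≡⟨ +-suc _ _ ⟩
    suc (edgesIn S) + length xs
      ≤⟨ +-monoˡ-≤ (length xs) (+-monoˡ-≤ (edgesIn S) has-neighbour) ⟩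
    length (neighbours v S) + edgesIn S + length xs  ≡⟨ cong (_+ length xs) (sym (edgesIn-∷ uvS)) ⟩
    edgesIn (v ∷ S) + length xs                      ≤⟨ edgesIn-reached T uvS ⟩
    edgesIn (reached (v ∷ S) xs)                     ∎
    where
    open ≤-Reasoning
    uvS : Unique (v ∷ S)
    uvS = unique-∷ v∉S uS
    nonempty : ∀ {N : List (Fin n)} {p} → p ∈ N → 1 ≤ length N
    nonempty (here _)  = s≤s z≤n
    nonempty (there _) = s≤s z≤n
    has-neighbour : 1 ≤ length (neighbours v S)
    has-neighbour = nonempty (∈-filter⁺ (λ z → adj G v z ≟ᵇ true) p∈S (~-sym p~v))

  -- Walks along a tree

  spin : ℕ → Fin n → Fin n → List (Fin n)
  spin zero    p v = []
  spin (suc c) p v = v ∷ p ∷ spin c p v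

  spin-walk : ∀ c {p v ws} → p ~ v → IsWalk G p ws → IsWalk G p (spin c p v ++ ws)
  spin-walk zero    _   iw = iw
  spin-walk (suc c) p~v iw = p~v , ~-sym p~v , spin-walk c p~v iw

  spin-extraDeg : ∀ c p v ws x →
    extraDeg p (spin c p v ++ ws) x ≡ 2 * c * ([ p ≡ᵇ x ] + [ v ≡ᵇ x ]) + extraDeg p ws x
  spin-extraDeg zero    p v ws x = refl
  spin-extraDeg (suc c) p v ws x =
    trans (cong (λ e → [ p ≡ᵇ x ] + [ v ≡ᵇ x ] + ([ v ≡ᵇ x ] + [ p ≡ᵇ x ] + e))
                (spin-extraDeg c p v ws x))
          (back-and-forth [ p ≡ᵇ x ] [ v ≡ᵇ x ] c (extraDeg p ws x))
    where
    back-and-forth : ∀ a b c e → a + b + (b + a + (2 * c * (a + b) + e)) ≡ 2 * suc c * (a + b) + e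
    back-and-forth = solve-∀

  spin-length : ∀ c p v ws → length (spin c p v ++ ws) ≡ 2 * c + length ws
  spin-length zero    p v ws = refl
  spin-length (suc c) p v ws =
    trans (cong (2 +_) (spin-length c p v ws)) (cong (_+ length ws) (sym (*-suc 2 c)))

  detour : ∀ {p} s ws → p ∈ s ∷ ws → ℕ → Fin n → List (Fin n)
  detour s ws       (here refl) c v = spin c s v ++ ws
  detour s (w ∷ ws) (there p∈)  c v = w ∷ detour w ws p∈ c v

  detour-walk : ∀ {p s ws} (p∈ : p ∈ s ∷ ws) c {v} → p ~ v → IsWalk G s ws →
    IsWalk G s (detour s ws p∈ c v)
  detour-walk              (here refl) c p~v iw         = spin-walk c p~v iw
  detour-walk {ws = _ ∷ _} (there p∈)  c p~v (s~w , iw) = s~w , detour-walk p∈ c p~v iw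

  detour-extraDeg : ∀ {p s ws} (p∈ : p ∈ s ∷ ws) c v x →
    extraDeg s (detour s ws p∈ c v) x ≡ 2 * c * ([ p ≡ᵇ x ] + [ v ≡ᵇ x ]) + extraDeg s ws x
  detour-extraDeg {ws = ws} (here refl) c v x = spin-extraDeg c _ v ws x
  detour-extraDeg {p} {s} {w ∷ ws} (there p∈) c v x =
    trans (cong ([ s ≡ᵇ x ] + [ w ≡ᵇ x ] +_) (detour-extraDeg p∈ c v x))
          (x∙yz≈y∙xz ([ s ≡ᵇ x ] + [ w ≡ᵇ x ]) (2 * c * ([ p ≡ᵇ x ] + [ v ≡ᵇ x ]))
                     (extraDeg w ws x))

  detour-length : ∀ {p s ws} (p∈ : p ∈ s ∷ ws) c v →
    length (detour s ws p∈ c v) ≡ 2 * c + length ws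
  detour-length {ws = ws}    (here refl) c v = spin-length c _ v ws
  detour-length {ws = _ ∷ _} (there p∈)  c v =
    trans (cong suc (detour-length p∈ c v)) (sym (+-suc _ _))

  detour-keeps : ∀ {p s ws y} (p∈ : p ∈ s ∷ ws) c v →
    y ∈ s ∷ ws → y ∈ s ∷ detour s ws p∈ c v
  detour-keeps              (here refl) c v (here y≡s)   = here y≡s
  detour-keeps              (here refl) c v (there y∈ws) = there (∈-++⁺ʳ (spin c _ v) y∈ws)
  detour-keeps {ws = _ ∷ _} (there p∈)  c v (here y≡s)   = here y≡s
  detour-keeps {ws = _ ∷ _} (there p∈)  c v (there y∈)   = there (detour-keeps p∈ c v y∈)

  detour-visits : ∀ {p s ws} (p∈ : p ∈ s ∷ ws) c v → v ∈ s ∷ detour s ws p∈ (suc c) v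
  detour-visits              (here refl) c v = there (here refl)
  detour-visits {ws = _ ∷ _} (there p∈)  c v = there (detour-visits p∈ c v)

  -- (v , p , k): the walk goes back and forth k + 1 times along the tree edge from p to v.
  Entry : Set
  Entry = Fin n × Fin n × ℕ

  treeEdge : Entry → Fin n × Fin n
  treeEdge (v , p , _) = v , p

  surplus : List Entry → ℕ
  surplus []                = 0
  surplus ((_ , _ , k) ∷ F) = k + surplus F

  load : List Entry → Fin n → ℕ
  load []                x = 0
  load ((v , p , k) ∷ F) x = 2 * suc k * ([ p ≡ᵇ x ] + [ v ≡ᵇ x ]) + load F x

  degree : List Entry → Fin n → ℕ
  degree F x = deg G x + load F x

  realise : ∀ {S s ws} F → TreeOrder S (map treeEdge F) → IsWalk G s ws →
    (∀ {y} → y ∈ S → y ∈ s ∷ ws) →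
    ∃[ ws′ ] IsWalk G s ws′
           × (∀ x → extraDeg s ws′ x ≡ load F x + extraDeg s ws x)
           × length ws′ ≡ 2 * (length F + surplus F) + length ws
  realise []                []                   iw _  = _ , iw , (λ _ → refl) , refl
  realise {s = s} {ws} ((v , p , k) ∷ F) (attach p∈S p~v _ T) iw S⊆ =
    let p∈  = S⊆ p∈S
        ws′ , iw′ , extra′ , length′ =
          realise F T (detour-walk p∈ (suc k) p~v iw)
            λ { (here refl) → detour-visits p∈ k v
              ; (there y∈S) → detour-keeps p∈ (suc k) v (S⊆ y∈S) }
    in ws′ , iw′
     , (λ x → trans (extra′ x)
                (trans (cong (load F x +_) (detour-extraDeg p∈ (suc k) v x))
                       (x∙yz≈yx∙z (load F x) (2 * suc k * ([ p ≡ᵇ x ] + [ v ≡ᵇ x ]))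
                                  (extraDeg s ws x))))
     , trans length′ (trans (cong (2 * (length F + surplus F) +_) (detour-length p∈ (suc k) v))
                            (regroup (length F) (surplus F) k (length ws)))
    where
    regroup : ∀ l s k w → 2 * (l + s) + (2 * suc k + w) ≡ 2 * (suc l + (k + s)) + w
    regroup = solve-∀

  -- Choosing the multiplicities

  IrregularOn : List (Fin n) → (Fin n → ℕ) → Set
  IrregularOn P D = ∀ {y z} → y ∈ P → z ∈ P → y ~ z → D y ≢ D z

  irregularOn-∷ : ∀ {v P D} → IrregularOn P D → (∀ {z} → z ∈ P → v ~ z → D v ≢ D z) →
    IrregularOn (v ∷ P) D
  irregularOn-∷ _   _   (here refl)  (here refl)  v~v = ⊥-elim (~-irrefl v~v refl)
  irregularOn-∷ _   new (here refl)  (there z∈P) v~z = new z∈P v~z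
  irregularOn-∷ _   new (there y∈P) (here refl)  y~v = new y∈P (~-sym y~v) ∘ sym
  irregularOn-∷ irr _   (there y∈P) (there z∈P) y~z = irr y∈P z∈P y~z

  irregularOn-resp : ∀ {P D D′} → (∀ {z} → z ∈ P → D′ z ≡ D z) →
    IrregularOn P D → IrregularOn P D′
  irregularOn-resp same irr y∈P z∈P y~z eq =
    irr y∈P z∈P y~z (trans (sym (same y∈P)) (trans eq (same z∈P)))

  degree-untouched : ∀ {v p x} k F → v ≢ x → p ≢ x → degree ((v , p , k) ∷ F) x ≡ degree F x
  degree-untouched {x = x} k F v≢x p≢x =
    cong (λ t → deg G x + (t + load F x))
         (trans (cong (2 * suc k *_) (cong₂ _+_ (≡ᵇ-≢ p≢x) (≡ᵇ-≢ v≢x)))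
                (*-zeroʳ (2 * suc k)))

  degree-raised : ∀ {v p x} k F → [ p ≡ᵇ x ] + [ v ≡ᵇ x ] ≡ 1 →
    degree ((v , p , k) ∷ F) x ≡ degree F x + 2 * suc k
  degree-raised {x = x} k F hit =
    trans (cong (λ t → deg G x + (t + load F x))
                (trans (cong (2 * suc k *_) hit) (*-identityʳ (2 * suc k))))
          (x∙yz≈xz∙y (deg G x) (2 * suc k) (load F x))

  degree-child : ∀ {v p} k F → p ≢ v → degree ((v , p , k) ∷ F) v ≡ degree F v + 2 * suc k
  degree-child {v} {p} k F p≢v =
    degree-raised {v} {p} {v} k F (cong₂ _+_ (≡ᵇ-≢ p≢v) (≡ᵇ-refl v))

  degree-parent : ∀ {v p} k F → v ≢ p → degree ((v , p , k) ∷ F) p ≡ degree F p + 2 * suc k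
  degree-parent {v} {p} k F v≢p =
    degree-raised {v} {p} {p} k F (cong₂ _+_ (≡ᵇ-refl p) (≡ᵇ-≢ v≢p))

  record ShiftAt (F : List Entry) (v p : Fin n) (P : List (Fin n)) (extra : List (ℕ × ℕ)) : Set where
    field
      k         : ℕ
      k≤        : k ≤ length (neighbours v P) + length extra
      irregular : IrregularOn (v ∷ P) (degree ((v , p , k) ∷ F))
      avoids    : All (Avoids k) extra

  shiftAt : ∀ F {v p P} extra → v ∉ P → p ∉ v ∷ P → IrregularOn P (degree F) →
    ShiftAt F v p P extra
  shiftAt F {v} {p} {P} extra v∉P p∉vP irr
    with chooseShift (map (λ z → degree F v , degree F z) (neighbours v P) ++ extra)
  ... | k , k≤ , avoids = record
    { k         = k
    ; k≤        = subst (k ≤_) (trans (length-++ constraints)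
                                      (cong (_+ length extra) (length-map compare N))) k≤
    ; irregular = irregularOn-∷ (irregularOn-resp unchanged irr) new
    ; avoids    = ++⁻ʳ constraints avoids
    }
    where
    N : List (Fin n)
    N = neighbours v P
    compare : Fin n → ℕ × ℕ
    compare z = degree F v , degree F z
    constraints : List (ℕ × ℕ)
    constraints = map compare N
    unchanged : ∀ {z} → z ∈ P → degree ((v , p , k) ∷ F) z ≡ degree F z
    unchanged z∈P = degree-untouched k F (distinct v∉P z∈P) (distinct (p∉vP ∘ there) z∈P)
    new : ∀ {z} → z ∈ P → v ~ z → degree ((v , p , k) ∷ F) v ≢ degree ((v , p , k) ∷ F) z
    new z∈P v~z eq = All.lookup (map⁻ (++⁻ˡ constraints avoids)) (∈-filter⁺ _ z∈P v~z)
                       (trans (sym (degree-child k F (p∉vP ∘ here))) (trans eq (unchanged z∈P)))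

  record Settling (P : List (Fin n)) (xs : List (Fin n × Fin n)) : Set where
    constructor settling
    field
      entries    : List Entry
      tree-edges : map treeEdge entries ≡ xs
      surplus≤   : surplus entries ≤ edgesIn P
      irregular  : IrregularOn P (degree entries)

  settling-∷ : ∀ {v p P xs} → Unique (v ∷ P) → p ∉ v ∷ P → Settling P xs →
    Settling (v ∷ P) ((v , p) ∷ xs)
  settling-∷ {v} {p} {P} uvP@(v∉P ∷ _) p∉vP (settling F edges s≤ irr) =
    settling ((v , p , k) ∷ F) (cong ((v , p) ∷_) edges) bound irregular
    where
    open ShiftAt (shiftAt F [] (All¬⇒¬Any v∉P) p∉vP irr)
    bound : k + surplus F ≤ edgesIn (v ∷ P)
    bound = subst (k + surplus F ≤_) (sym (edgesIn-∷ uvP))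
                  (+-mono-≤ (≤-trans k≤ (≤-reflexive (+-identityʳ _))) s≤)

  settle : ∀ {S xs} → TreeOrder S xs → Settling (vertices xs) xs
  settle [] = settling [] refl z≤n λ ()
  settle {S} T@(attach {v = v} {p} {xs} p∈S _ v∉S T′) =
    settling-∷ (vertices-unique T) parent-fresh (settle T′)
    where
    parent-fresh : p ∉ v ∷ vertices xs
    parent-fresh (here p≡v) = v∉S (subst (_∈ S) p≡v p∈S)
    parent-fresh (there p∈) = fresh T′ (there p∈S) p∈

  fork-budget : ∀ {r B A P a b s} → Unique (r ∷ B ∷ A ∷ P) → r ~ B →
    a ≤ length (neighbours A P) + 1 →
    b ≤ length (neighbours B (A ∷ P)) + length (neighbours r (A ∷ P)) →
    s ≤ edgesIn P →
    b + (a + s) ≤ edgesIn (r ∷ B ∷ A ∷ P)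
  fork-budget {r} {B} {A} {P} {a} {b} {s} U@(_ ∷ uBAP@(_ ∷ uAP)) r~B a≤ b≤ s≤ = begin
    b + (a + s)                       ≤⟨ +-mono-≤ b≤ (+-mono-≤ a≤ s≤) ⟩
    nB + nr + (nA + 1 + edgesIn P)    ≡⟨ regroup nB nr nA (edgesIn P) ⟩
    suc nr + (nB + (nA + edgesIn P))
      ≡⟨ cong₂ _+_ (cong length (sym (filter-accept (λ z → adj G r z ≟ᵇ true) r~B)))
                   (cong (nB +_) (sym (edgesIn-∷ uAP))) ⟩
    length (neighbours r (B ∷ A ∷ P)) + (nB + edgesIn (A ∷ P))
      ≡⟨ cong (length (neighbours r (B ∷ A ∷ P)) +_) (sym (edgesIn-∷ uBAP)) ⟩
    length (neighbours r (B ∷ A ∷ P)) + edgesIn (B ∷ A ∷ P)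
      ≡⟨ sym (edgesIn-∷ U) ⟩
    edgesIn (r ∷ B ∷ A ∷ P) ∎
    where
    open ≤-Reasoning
    nA nB nr : ℕ
    nA = length (neighbours A P)
    nB = length (neighbours B (A ∷ P))
    nr = length (neighbours r (A ∷ P))
    regroup : ∀ b r a e → b + r + (a + 1 + e) ≡ suc r + (b + (a + e))
    regroup = solve-∀

  settleRoot : ∀ {r B A R} → TreeOrder (r ∷ []) ((B , r) ∷ (A , r) ∷ R) →
    Settling (r ∷ B ∷ A ∷ vertices R) ((B , r) ∷ (A , r) ∷ R)
  settleRoot {r} {B} {A} {R} T@(attach _ r~B _ (attach _ _ _ T₀))
    with rooted-unique T | settle T₀
  ... | U@(r∉BAP ∷ (B∉AP ∷ (A∉P ∷ _))) | settling F₀ edges₀ s₀ irr₀ =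
    settling F₂ (cong (λ es → (B , r) ∷ (A , r) ∷ es) edges₀) bound
             (irregularOn-∷ Last.irregular root-new)
    where
    P₀ : List (Fin n)
    P₀ = vertices R
    r≢B : r ≢ B
    r≢B = All.head r∉BAP
    r≢A : r ≢ A
    r≢A = All.head (All.tail r∉BAP)
    B≢A : B ≢ A
    B≢A = All.head B∉AP
    r∉AP : r ∉ A ∷ P₀
    r∉AP = All¬⇒¬Any (All.tail r∉BAP)

    module First =
      ShiftAt (shiftAt F₀ [ (degree F₀ r , degree F₀ B) ] (All¬⇒¬Any A∉P) r∉AP irr₀)
    F₁ : List Entry
    F₁ = (A , r , First.k) ∷ F₀
    rConstraints : List (ℕ × ℕ)
    rConstraints = map (λ z → degree F₁ r , degree F₁ z) (neighbours r (A ∷ P₀))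
    module Last =
      ShiftAt (shiftAt F₁ rConstraints (All¬⇒¬Any B∉AP) (All¬⇒¬Any r∉BAP) First.irregular)
    F₂ : List Entry
    F₂ = (B , r , Last.k) ∷ F₁

    root-new : ∀ {z} → z ∈ B ∷ A ∷ P₀ → r ~ z → degree F₂ r ≢ degree F₂ z
    root-new (here refl) _ eq = All.head First.avoids (begin
      degree F₀ r + 2 * suc First.k  ≡⟨ sym (degree-parent First.k F₀ (r≢A ∘ sym)) ⟩
      degree F₁ r
        ≡⟨ +-cancelʳ-≡ _ _ _ (trans (sym (degree-parent Last.k F₁ (r≢B ∘ sym)))
                                    (trans eq (degree-child Last.k F₁ r≢B))) ⟩
      degree F₁ B                    ≡⟨ degree-untouched First.k F₀ (B≢A ∘ sym) r≢B ⟩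
      degree F₀ B                    ∎)
      where open ≡-Reasoning
    root-new (there z∈AP) r~z eq =
      All.lookup (map⁻ Last.avoids) (∈-filter⁺ (λ z → adj G r z ≟ᵇ true) z∈AP r~z)
        (trans (sym (degree-parent Last.k F₁ (r≢B ∘ sym)))
               (trans eq (degree-untouched Last.k F₁ (distinct (All¬⇒¬Any B∉AP) z∈AP)
                                                    (distinct r∉AP z∈AP))))

    bound : Last.k + (First.k + surplus F₀) ≤ edgesIn (r ∷ B ∷ A ∷ P₀)
    bound = fork-budget U r~B First.k≤ Last-k≤ s₀
      where
      Last-k≤ : Last.k ≤ length (neighbours B (A ∷ P₀)) + length (neighbours r (A ∷ P₀))
      Last-k≤ = subst (Last.k ≤_)
                      (cong (length (neighbours B (A ∷ P₀)) +_)
                            (length-map (λ z → degree F₁ r , degree F₁ z) (neighbours r (A ∷ P₀))))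
                      Last.k≤

  walkBounds : ∀ {r xs} → TreeOrder (r ∷ []) xs → (∀ x → x ∈ reached (r ∷ []) xs) →
    Settling (r ∷ vertices xs) xs → MLW≤ G (2 * (edges G + n ∸ 1)) × MLW≤ G (4 * edges G)
  walkBounds {r} T spans (settling F refl s≤ irr) with realise F T tt (λ y∈ → y∈)
  ... | ws , iw , extra , len =
    (W , irregularising , length≤₁) , (W , irregularising , length≤₂)
    where
    W : Walk G
    W = walk r ws iw
    degPlus≡ : ∀ x → degPlus G W x ≡ degree F x
    degPlus≡ x = cong (deg G x +_) (trans (extra x) (+-identityʳ _))
    covered : ∀ x → x ∈ r ∷ vertices (map treeEdge F)
    covered = rooted-spanning {xs = map treeEdge F} spans
    irregularising : Irregularising G W
    irregularising u v u~v eq =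
      irr (covered u) (covered v) u~v (trans (sym (degPlus≡ u)) (trans eq (degPlus≡ v)))
    l : ℕ
    l = length (map treeEdge F)
    length≡ : walkLength W ≡ 2 * (l + surplus F)
    length≡ = trans len (trans (+-identityʳ _)
                               (cong (λ t → 2 * (t + surplus F)) (sym (length-map treeEdge F))))
    l≤m : l ≤ edges G
    l≤m = ≤-trans (m≤n+m l (edgesIn (r ∷ [])))
                  (subst (edgesIn (r ∷ []) + l ≤_) (edgesIn-spanning spans)
                         (edgesIn-reached T ([] ∷ [])))
    s≤m : surplus F ≤ edges G
    s≤m = subst (surplus F ≤_) (edgesIn-spanning covered) s≤
    budget : 2 * (l + surplus F) ≤ 2 * (edges G + n ∸ 1) × 2 * (l + surplus F) ≤ 4 * edges G
    budget = walk-budget (rooted-size T spans) l≤m s≤m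
    length≤₁ : walkLength W ≤ 2 * (edges G + n ∸ 1)
    length≤₁ = subst (_≤ _) (sym length≡) (proj₁ budget)
    length≤₂ : walkLength W ≤ 4 * edges G
    length≤₂ = subst (_≤ _) (sym length≡) (proj₂ budget)

  -- Spanning tree orders of connected graphs

  endpoint : Fin n → List (Fin n) → Fin n
  endpoint u []       = u
  endpoint u (w ∷ ws) = endpoint w ws

  -- Connected uses its own local endpoint function, which cannot be named here; any function
  -- satisfying its two defining equations agrees with endpoint.
  walkBetween : Connected G → ∀ u v → ∃[ ws ] IsWalk G u ws × endpoint u ws ≡ v
  walkBetween (_ , connected) = fromEquations (λ _ → refl) (λ _ _ _ → refl) connected
    where
    fromEquations : {end : Fin n → List (Fin n) → Fin n} →
      (∀ u → end u [] ≡ u) → (∀ u w ws → end u (w ∷ ws) ≡ end w ws) →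
      (∀ u v → ∃[ ws ] IsWalk G u ws × end u ws ≡ v) →
      ∀ u v → ∃[ ws ] IsWalk G u ws × endpoint u ws ≡ v
    fromEquations {end} end-[] end-∷ conn u v with conn u v
    ... | ws , iw , end≡v = ws , iw , trans (sym (agree u ws)) end≡v
      where
      agree : ∀ u ws → end u ws ≡ endpoint u ws
      agree u []       = end-[] u
      agree u (w ∷ ws) = trans (end-∷ u w ws) (agree w ws)

  leave : ∀ {T u} ws → IsWalk G u ws → u ∈ T → endpoint u ws ∉ T →
    ∃[ p ] ∃[ w ] p ∈ T × w ∉ T × p ~ w
  leave []       _          u∈T u∉T = ⊥-elim (u∉T u∈T)
  leave {T} {u} (w ∷ ws) (u~w , iw) u∈T end∉T with w ∈? T
  ... | yes w∈T = leave ws iw w∈T end∉T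
  ... | no  w∉T = u , w , u∈T , w∉T , u~w

  boundaryEdge : Connected G → ∀ {T r} → r ∈ T → ¬ (∀ x → x ∈ T) →
    ∃[ p ] ∃[ w ] p ∈ T × w ∉ T × p ~ w
  boundaryEdge connected {T} {r} r∈T ¬spans with ¬∀⟶∃¬ n (_∈ T) (_∈? T) ¬spans
  ... | x , x∉T with walkBetween connected r x
  ... | ws , iw , end≡x = leave ws iw r∈T (subst (_∉ T) (sym end≡x) x∉T)

  spanningOrder : Connected G → ∀ {S r} → Unique S → r ∈ S →
    ∃[ xs ] TreeOrder S xs × (∀ x → x ∈ reached S xs)
  spanningOrder connected {S} {r} uS r∈S = grow n (m≤m+n n (length S)) uS r∈S
    where
    grow : ∀ fuel {S} → n ≤ fuel + length S → Unique S → r ∈ S →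
      ∃[ xs ] TreeOrder S xs × (∀ x → x ∈ reached S xs)
    grow fuel {S} bound uS r∈S with all? (_∈? S)
    ... | yes spans = [] , [] , spans
    grow zero {S} bound uS r∈S | no ¬spans with ¬∀⟶∃¬ n (_∈ S) (_∈? S) ¬spans
    ... | x , x∉S = ⊥-elim (<-irrefl refl (≤-trans (unique-length-≤ (unique-∷ x∉S uS)) bound))
    grow (suc fuel) {S} bound uS r∈S | no ¬spans with boundaryEdge connected r∈S ¬spans
    ... | p , w , p∈S , w∉S , p~w
        with grow fuel (subst (n ≤_) (sym (+-suc fuel _)) bound) (unique-∷ w∉S uS) (there r∈S)
    ... | xs , T , spans = (w , p) ∷ xs , attach p∈S p~w w∉S T , spans

  fork : Connected G → Fin n → 3 ≤ n →
    ∃[ r ] ∃[ B ] ∃[ A ] TreeOrder (r ∷ []) ((B , r) ∷ (A , r) ∷ [])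
  fork connected x₀ 3≤n with spanningOrder connected {x₀ ∷ []} ([] ∷ []) (here refl)
  ... | _ , T , spans = forkOf T (≤-pred (subst (3 ≤_) (rooted-size T spans) 3≤n))
    where
    forkOf : ∀ {xs} → TreeOrder (x₀ ∷ []) xs → 2 ≤ length xs →
      ∃[ r ] ∃[ B ] ∃[ A ] TreeOrder (r ∷ []) ((B , r) ∷ (A , r) ∷ [])
    forkOf [] ()
    forkOf (attach _ _ _ []) (s≤s ())
    forkOf (attach {v = v₁} (here refl) x₀~v₁ v₁∉ (attach {v = v₂} (here refl) v₁~v₂ v₂∉ _)) _ =
      v₁ , x₀ , v₂ ,
      attach (here refl) (~-sym x₀~v₁) x₀∉ (attach (there (here refl)) v₁~v₂ v₂∉′ [])
      where
      x₀∉ : x₀ ∉ v₁ ∷ []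
      x₀∉ (here x₀≡v₁) = v₁∉ (here (sym x₀≡v₁))
      v₂∉′ : v₂ ∉ x₀ ∷ v₁ ∷ []
      v₂∉′ (here v₂≡x₀)         = v₂∉ (there (here v₂≡x₀))
      v₂∉′ (there (here v₂≡v₁)) = v₂∉ (here v₂≡v₁)
    forkOf (attach {v = v₁} (here refl) x₀~v₁ v₁∉ (attach {v = v₂} (there (here refl)) x₀~v₂ v₂∉ _)) _ =
      x₀ , v₁ , v₂ ,
      attach (here refl) x₀~v₁ v₁∉ (attach (there (here refl)) x₀~v₂ v₂∉ [])

  spanningFork : Connected G → Fin n → 3 ≤ n →
    ∃[ r ] ∃[ B ] ∃[ A ] ∃[ R ] TreeOrder (r ∷ []) ((B , r) ∷ (A , r) ∷ R)
                              × (∀ x → x ∈ reached (r ∷ []) ((B , r) ∷ (A , r) ∷ R))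
  spanningFork connected x₀ 3≤n with fork connected x₀ 3≤n
  ... | r , B , A , T@(attach r∈ r~B B∉ (attach r∈′ r~A A∉ []))
      with spanningOrder connected (reached-unique T ([] ∷ [])) (there (there (here refl)))
  ... | R , T₀ , spans = r , B , A , R , attach r∈ r~B B∉ (attach r∈′ r~A A∉ T₀) , spans

  walkBounds-≥3 : Connected G → Fin n → 3 ≤ n →
    MLW≤ G (2 * (edges G + n ∸ 1)) × MLW≤ G (4 * edges G)
  walkBounds-≥3 connected x₀ 3≤n with spanningFork connected x₀ 3≤n
  ... | _ , _ , _ , _ , T , spans = walkBounds T spans (settleRoot T)

singleVertex : (G : Graph 1) → ∀ k → MLW≤ G k
singleVertex G k = walk zero [] tt , (λ { zero zero u~u → ⊥-elim (~-irrefl G u~u refl) }) , z≤n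

twoVertexK₂ : (G : Graph 2) → Connected G → IsoK2 G
twoVertexK₂ G (_ , connected) = refl , complete
  where
  the-other : {u v w : Fin 2} → u ≢ v → u ≢ w → w ≡ v
  the-other {zero}     {zero}                 u≢v _   = ⊥-elim (u≢v refl)
  the-other {zero}     {suc zero} {zero}      _   u≢w = ⊥-elim (u≢w refl)
  the-other {zero}     {suc zero} {suc zero}  _   _   = refl
  the-other {suc zero} {zero}     {zero}      _   _   = refl
  the-other {suc zero} {zero}     {suc zero}  _   u≢w = ⊥-elim (u≢w refl)
  the-other {suc zero} {suc zero}             u≢v _   = ⊥-elim (u≢v refl)
  complete : ∀ u v → u ≢ v → adj G u v ≡ true
  complete u v u≢v with connected u v
  ... | []    , _         , u≡v = ⊥-elim (u≢v u≡v)
  ... | _ ∷ _ , (u~w , _) , _   = subst (λ y → adj G u y ≡ true) (the-other u≢v (~-irrefl G u~w)) u~w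

corollary4p2 : ∀ {n} (G : Graph n) → Nice G →
    MLW≤ G (2 * (edges G + n ∸ 1)) × MLW≤ G (4 * edges G)
corollary4p2 {zero} G ((() , _) , _)
corollary4p2 {1}    G _                   = singleVertex G _ , singleVertex G _
corollary4p2 {2}    G (connected , notK₂) = ⊥-elim (notK₂ (twoVertexK₂ G connected))
corollary4p2 {suc (suc (suc _))} G (connected , _) =
  walkBounds-≥3 G connected zero (s≤s (s≤s (s≤s z≤n)))
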